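{- Let $k\ge 2$ and $n>2k$, let $W$ be a $2k$-dimensional left vector space over a division ring, and let $X=\{x_1,\dots,x_n\}\subset W$ and $Y=\{y^{*}_1,\dots,y^{*}_n\}\subset W^{*}$ be $2k$-independent $n$-element subsets. Let $U_i\subset W$ be the annihilator of $y^{*}_i$, and assume: every $U_i$ is spanned by a subset of $X$, and every $\langle x_i\rangle$ is the intersection of some of the $U_j$. Let $\mathcal{Z}=\mathcal{J}_k(X)\cap\mathcal{J}^{*}_k(Y)$. Then $|\mathcal{Z}|<a(n,k):=\binom{n-2}{k-2}+\binom{n-1}{k}$.
   Context: A subset of a vector space is $2k$-independent if each of its $2k$-element subsets is linearly independent. $\mathcal{J}_k(X)$ is the set of $k$-dimensional subspaces of $W$ spanned by $k$-element subsets of $X$. $\mathcal{J}^{*}_k(Y)$ is the set of annihilators in $W$ (identifying $W^{**}$ with $W$) of the $k$-dimensional subspaces of $W^{*}$ spanned by $k$-element subsets of $Y$. -}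

module Defs where

open import Level using (Level; _⊔_; Lift) renaming (suc to lsuc)
open import Algebra.Bundles using (Ring)
open import Data.Nat as ℕ using (ℕ; zero; suc; _∸_)
open import Data.Nat.Combinatorics using (_C_)
open import Data.Fin using (Fin) renaming (zero to fzero; suc to fsuc)
open import Data.Fin.Subset using (Subset; _∈_)
open import Data.Bool using (Bool; true; false)
open import Data.Vec using (lookup)
open import Data.Product using (Σ; ∃; _×_; _,_)
open import Relation.Nullary using (¬_)

record DivisionRing (c ℓ : Level) : Set (lsuc (c ⊔ ℓ)) where
  field
    ring : Ring c ℓ
  open Ring ring public
  field
    1≉0     : ¬ (1# ≈ 0#)
    inverse : ∀ a → ¬ (a ≈ 0#) → Σ Carrier λ b → (a * b ≈ 1#) × (b * a ≈ 1#)

-- W = D^d (left vector space, scalars act on the left),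
-- W* = D^d viewed as linear functionals w ↦ Σ_j w_j * f_j
-- (a right vector space: (f·μ)(w) = f(w)·μ).
module LinAlg {c ℓ} (D : DivisionRing c ℓ) where
  open DivisionRing D

  Σ[_] : ∀ {m} → (Fin m → Carrier) → Carrier
  Σ[_] {zero}  f = 0#
  Σ[_] {suc m} f = f fzero + Σ[ (λ i → f (fsuc i)) ]

  ΣIn : ∀ {m} → Subset m → (Fin m → Carrier) → Carrier
  ΣIn S f = Σ[ (λ i → sel (lookup S i) (f i)) ]
    where
    sel : Bool → Carrier → Carrier
    sel true  x = x
    sel false _ = 0#

  Vect : ℕ → Set c
  Vect d = Fin d → Carrier

  _≋_ : ∀ {d} → Vect d → Vect d → Set ℓ
  v ≋ w = ∀ p → v p ≈ w p

  0v : ∀ {d} → Vect d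
  0v _ = 0#

  ⟪_,_⟫ : ∀ {d} → Vect d → Vect d → Carrier
  ⟪ w , f ⟫ = Σ[ (λ p → w p * f p) ]

  lcomb : ∀ {d n} → (Fin n → Vect d) → Subset n → (Fin n → Carrier) → Vect d
  lcomb x S a p = ΣIn S (λ j → a j * x j p)

  rcomb : ∀ {d n} → (Fin n → Vect d) → Subset n → (Fin n → Carrier) → Vect d
  rcomb y S a p = ΣIn S (λ j → y j p * a j)

  -- Subspaces of W are represented by their membership predicates.
  Pred : ℕ → Set (lsuc (c ⊔ ℓ))
  Pred d = Vect d → Set (c ⊔ ℓ)

  _≐_ : ∀ {d} → Pred d → Pred d → Set (c ⊔ ℓ)
  U ≐ V = ∀ w → ((U w → V w) × (V w → U w))

  spanL : ∀ {d n} → (Fin n → Vect d) → Subset n → Pred d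
  spanL x S w = ∃ λ a → w ≋ lcomb x S a

  spanR : ∀ {d n} → (Fin n → Vect d) → Subset n → Pred d
  spanR y S f = ∃ λ a → f ≋ rcomb y S a

  ann : ∀ {d} → Pred d → Pred d
  ann V w = ∀ f → V f → ⟪ w , f ⟫ ≈ 0#

  ker : ∀ {d} → Vect d → Pred d
  ker f w = Lift c (⟪ w , f ⟫ ≈ 0#)

  ⋂ : ∀ {d n} → (Fin n → Pred d) → Subset n → Pred d
  ⋂ U T w = ∀ j → j ∈ T → U j w

  IndepL : ∀ {d n} → (Fin n → Vect d) → Subset n → Set (c ⊔ ℓ)
  IndepL x S = ∀ a → lcomb x S a ≋ 0v → ∀ j → j ∈ S → a j ≈ 0#

  IndepR : ∀ {d n} → (Fin n → Vect d) → Subset n → Set (c ⊔ ℓ)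
  IndepR y S = ∀ a → rcomb y S a ≋ 0v → ∀ j → j ∈ S → a j ≈ 0#

  open import Data.Fin.Subset using (∣_∣)
  open import Relation.Binary.PropositionalEquality using (_≡_)
  IndepLOf : ∀ {d n} → ℕ → (Fin n → Vect d) → Set (c ⊔ ℓ)
  IndepLOf m x = ∀ S → ∣ S ∣ ≡ m → IndepL x S

  IndepROf : ∀ {d n} → ℕ → (Fin n → Vect d) → Set (c ⊔ ℓ)
  IndepROf m y = ∀ S → ∣ S ∣ ≡ m → IndepR y S

a : ℕ → ℕ → ℕ
a n k = ((n ∸ 2) C (k ∸ 2)) ℕ.+ ((n ∸ 1) C k)

-- Write the members of 𝒵 as span x (F i) = ann (span y (T i)) with ∣ F i ∣ = ∣ T i ∣ = k, and for
-- each functional y b let Z b be the union of the F i with b ∈ T i.  Every x u with u ∈ Z b lies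
-- in the kernel of y b ≠ 0, so 2k-independence forces ∣ Z b ∣ ≤ 2k - 1, and the F i with b ∈ T i
-- are distinct k-subsets of Z b: there are at most C(2k-1, k) of them.  Double counting the pairs
-- (i, b) with b ∈ T i gives m k ≤ n C(2k-1, k), which is below k a(n, k) unless k = 2 and n = 5.
-- In that case the bound still allows m = 7; this is excluded by parity, since the incidence
-- numbers V b u = #{i | b ∈ T i, u ∈ F i} have even row and column sums.

module Submission where

module Binomial where

  open import Data.Nat
  open import Data.Nat.Properties
  open import Data.Nat.Combinatorics using (_C_; nCk+nC[k+1]≡[n+1]C[k+1]; nCk≡nC[n∸k]; nC1≡n)
  open import Data.Nat.Tactic.RingSolver using (solve-∀)
  open import Data.Product using (_×_; _,_)
  open import Relation.Binary.PropositionalEquality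
  open import Relation.Nullary using (¬_; yes; no)
  open import Relation.Nullary.Decidable using (toWitness)
  open import Defs using (a)

  pascal : ∀ n k → suc n C suc k ≡ n C k + n C suc k
  pascal n k = sym (nCk+nC[k+1]≡[n+1]C[k+1] n k)

  C-suc-≤ : ∀ n k → n C k ≤ suc n C k
  C-suc-≤ n zero    = ≤-refl
  C-suc-≤ n (suc k) = ≤-trans (m≤n+m _ _) (≤-reflexive (sym (pascal n k)))

  C-monoˡ-≤ : ∀ k {m n} → m ≤ n → m C k ≤ n C k
  C-monoˡ-≤ k m≤n = go (≤⇒≤′ m≤n)
    where
    go : ∀ {m n} → m ≤′ n → m C k ≤ n C k
    go ≤′-refl        = ≤-refl
    go (≤′-step m≤′n) = ≤-trans (go m≤′n) (C-suc-≤ _ k)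

  C-pos : ∀ {n k} → k ≤ n → 0 < n C k
  C-pos {n}     {zero}  _         = s≤s z≤n
  C-pos {suc n} {suc k} (s≤s k≤n) = ≤-trans (C-pos k≤n) (≤-trans (m≤m+n _ _) (≤-reflexive (sym (pascal n k))))

  -- (j+1) C(N,j+1) = (N-j) C(N,j), with the subtraction moved to the other side.
  C-absorption : ∀ N j → suc j * (N C suc j) + j * (N C j) ≡ N * (N C j)
  C-absorption zero    zero    = refl
  C-absorption zero    (suc j) = cong₂ _+_ (*-zeroʳ (2 + j)) (*-zeroʳ (1 + j))
  C-absorption (suc N) zero    =
    trans (cong (_+ 0) (*-identityˡ _)) (trans (+-identityʳ _) (trans (nC1≡n (suc N)) (sym (*-identityʳ _))))
  C-absorption (suc N) (suc j) = begin
    (2 + j) * (suc N C (2 + j)) + (1 + j) * (suc N C (1 + j))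
      ≡⟨ cong₂ (λ u v → (2 + j) * u + (1 + j) * v) (pascal N (suc j)) (pascal N j) ⟩
    (2 + j) * (Y + Z) + (1 + j) * (X + Y)
      ≡⟨ regroup j X Y Z ⟩
    ((2 + j) * Z + (1 + j) * Y) + ((1 + j) * Y + j * X) + Y + X
      ≡⟨ cong₂ (λ u v → u + v + Y + X) (C-absorption N (suc j)) (C-absorption N j) ⟩
    N * Y + N * X + Y + X
      ≡⟨ collect N X Y ⟩
    suc N * (X + Y)
      ≡⟨ cong (suc N *_) (sym (pascal N j)) ⟩
    suc N * (suc N C suc j) ∎
    where
    open ≡-Reasoning
    X = N C j
    Y = N C suc j
    Z = N C suc (suc j)
    regroup : ∀ j X Y Z → (2 + j) * (Y + Z) + (1 + j) * (X + Y) ≡ ((2 + j) * Z + (1 + j) * Y) + ((1 + j) * Y + j * X) + Y + X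
    regroup = solve-∀
    collect : ∀ N X Y → N * Y + N * X + Y + X ≡ suc N * (X + Y)
    collect = solve-∀

  C-middle : ∀ i → suc (2 * i) C suc i ≡ suc (2 * i) C i
  C-middle i = trans (nCk≡nC[n∸k] (s≤s (m≤m+n i (i + 0))))
                     (cong (suc (2 * i) C_) (trans (m+n∸m≡n i (i + 0)) (+-identityʳ i)))

  Bound : ℕ → ℕ → Set
  Bound j n = n * (suc (2 * suc j) C (2 + j)) < (2 + j) * a n (2 + j)

  a-growth : ∀ j m → suc m C suc j + a (2 + m) (2 + j) ≤ a (3 + m) (2 + j)
  a-growth j m = begin
    X + (m C j + Y)           ≤⟨ +-monoʳ-≤ X (+-monoˡ-≤ Y (C-suc-≤ m j)) ⟩
    X + (suc m C j + Y)       ≡⟨ x+[y+z]≡y+[x+z] X (suc m C j) Y ⟩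
    suc m C j + (X + Y)       ≡⟨ cong (suc m C j +_) (sym (pascal (suc m) (suc j))) ⟩
    a (3 + m) (2 + j)         ∎
    where
    open ≤-Reasoning
    X = suc m C suc j
    Y = suc m C (2 + j)
    x+[y+z]≡y+[x+z] : ∀ x y z → x + (y + z) ≡ y + (x + z)
    x+[y+z]≡y+[x+z] = solve-∀

  bound-step : ∀ j m → 2 * suc j ≤ m → Bound j (2 + m) → Bound j (3 + m)
  bound-step j m 2k≤n b = begin-strict
    c + (2 + m) * c             <⟨ +-monoʳ-< c b ⟩
    c + k * a (2 + m) k         ≤⟨ +-monoˡ-≤ (k * a (2 + m) k) c≤kX ⟩
    k * X + k * a (2 + m) k     ≡⟨ sym (*-distribˡ-+ k X _) ⟩
    k * (X + a (2 + m) k)       ≤⟨ *-monoʳ-≤ k (a-growth j m) ⟩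
    k * a (3 + m) k             ∎
    where
    open ≤-Reasoning
    k = 2 + j
    c = suc (2 * suc j) C k
    X = suc m C suc j
    c≤kX : c ≤ k * X
    c≤kX = begin
      c                          ≡⟨ C-middle (suc j) ⟩
      suc (2 * suc j) C suc j    ≤⟨ C-monoˡ-≤ (suc j) (s≤s 2k≤n) ⟩
      X                          ≤⟨ m≤m+n X _ ⟩
      k * X                      ∎

  bound-lift : ∀ j {m₀ m} → 2 * suc j ≤ m₀ → Bound j (2 + m₀) → m₀ ≤′ m → Bound j (2 + m)
  bound-lift j 2k≤m₀ b ≤′-refl         = b
  bound-lift j 2k≤m₀ b (≤′-step m₀≤′m) =
    bound-step j _ (≤-trans 2k≤m₀ (≤′⇒≤ m₀≤′m)) (bound-lift j 2k≤m₀ b m₀≤′m)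

  bound-k≡2-n≡6 : Bound 0 6
  bound-k≡2-n≡6 = toWitness {a? = 6 * (3 C 2) <? 2 * a 6 2} _

  -- The base case n = 2k + 1 for k = 3 + j; it fails for k = 2.
  bound-n≡2k+1 : ∀ j → Bound (suc j) (3 + 2 * (2 + j))
  bound-n≡2k+1 j = begin-strict
    (2 + N) * c                 ≡⟨ +-comm c _ ⟩
    (1 + N) * c + c             <⟨ +-monoʳ-< ((1 + N) * c) c<kb₁ ⟩
    (1 + N) * c + (3 + j) * b₁  ≡⟨ regroup j c b₁ ⟩
    (3 + j) * (b₁ + (c + c))    ≡⟨ cong (λ z → (3 + j) * (b₁ + (z + c))) (C-middle (2 + j)) ⟩
    (3 + j) * (b₁ + (b₂ + c))   ≡⟨ cong (λ z → (3 + j) * (b₁ + z)) (sym (pascal N (2 + j))) ⟩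
    (3 + j) * a (2 + N) (3 + j) ∎
    where
    open ≤-Reasoning
    N = suc (2 * (2 + j))
    c = N C (3 + j)
    b₂ = N C (2 + j)
    b₁ = N C (1 + j)
    regroup : ∀ j c b → (2 + 2 * (2 + j)) * c + (3 + j) * b ≡ (3 + j) * (b + (c + c))
    regroup = solve-∀
    [2+j]c≡[4+j]b₁ : (2 + j) * c ≡ (4 + j) * b₁
    [2+j]c≡[4+j]b₁ = +-cancelʳ-≡ ((1 + j) * b₁) _ _ (begin-equality
      (2 + j) * c + (1 + j) * b₁   ≡⟨ cong (λ z → (2 + j) * z + (1 + j) * b₁) (C-middle (2 + j)) ⟩
      (2 + j) * b₂ + (1 + j) * b₁  ≡⟨ C-absorption N (suc j) ⟩
      N * b₁                       ≡⟨ split j b₁ ⟩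
      (4 + j) * b₁ + (1 + j) * b₁  ∎)
      where
      split : ∀ j b → suc (2 * (2 + j)) * b ≡ (4 + j) * b + (1 + j) * b
      split = solve-∀
    4+j<[2+j][3+j] : 4 + j < (2 + j) * (3 + j)
    4+j<[2+j][3+j] = ≤-trans (m≤m+n (5 + j) _) (≤-reflexive (expand j))
      where
      expand : ∀ j → 5 + j + (1 + (j * j + 4 * j)) ≡ (2 + j) * (3 + j)
      expand = solve-∀
    0<b₁ : 0 < b₁
    0<b₁ = C-pos (s≤s (≤-trans (m≤n+m j 2) (m≤m+n (2 + j) _)))
    c<kb₁ : c < (3 + j) * b₁
    c<kb₁ = *-cancelˡ-< (2 + j) c _ (begin-strict
      (2 + j) * c                 ≡⟨ [2+j]c≡[4+j]b₁ ⟩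
      (4 + j) * b₁                <⟨ *-monoˡ-< b₁ {{>-nonZero 0<b₁}} 4+j<[2+j][3+j] ⟩
      (2 + j) * (3 + j) * b₁      ≡⟨ *-assoc (2 + j) (3 + j) b₁ ⟩
      (2 + j) * ((3 + j) * b₁)    ∎)

  bound : ∀ j n → 2 * (2 + j) < n → ¬ (j ≡ 0 × n ≡ 5) → Bound j n
  bound j       zero          ()
  bound j       (suc zero)    (s≤s ())
  bound zero    (suc (suc m)) (s≤s (s≤s 3≤m)) n≢5 =
    bound-lift 0 (s≤s (s≤s z≤n)) bound-k≡2-n≡6 (≤⇒≤′ (≤∧≢⇒< 3≤m λ 3≡m → n≢5 (refl , cong (2 +_) (sym 3≡m))))
  bound (suc j) (suc (suc m)) 2k<n _ =
    bound-lift (suc j) (n≤1+n _) (bound-n≡2k+1 j) (≤⇒≤′ (≤-pred (≤-trans (≤-reflexive (shift j)) (≤-pred 2k<n))))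
    where
    shift : ∀ j → 2 + 2 * (2 + j) ≡ 2 * (3 + j)
    shift = solve-∀

  m<a-generic : ∀ k n m → 2 ≤ k → 2 * k < n → ¬ (k ≡ 2 × n ≡ 5) → m * k ≤ n * ((2 * k ∸ 1) C k) → m < a n k
  m<a-generic (suc (suc j)) n m (s≤s (s≤s z≤n)) 2k<n not-2,5 mk≤ = *-cancelʳ-< k m (a n k) (begin-strict
    m * k                        ≤⟨ mk≤ ⟩
    n * ((2 * k ∸ 1) C k)        ≡⟨ cong (λ z → n * (z C k)) (cong suc (+-suc j (suc j + 0))) ⟩
    n * (suc (2 * suc j) C k)    <⟨ bound j n 2k<n (λ { (refl , n≡5) → not-2,5 (refl , n≡5) }) ⟩
    k * a n k                    ≡⟨ *-comm k (a n k) ⟩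
    a n k * k                    ∎)
    where
    open ≤-Reasoning
    k = 2 + j

  -- For k = 2, n = 5 the counting bound only gives m ≤ 7 = a(5, 2).
  m<a : ∀ k n m → 2 ≤ k → 2 * k < n → m * k ≤ n * ((2 * k ∸ 1) C k) → (k ≡ 2 → n ≡ 5 → m ≢ 7) → m < a n k
  m<a k n m 2≤k 2k<n mk≤ m≢7 with k ≟ 2 | n ≟ 5
  ... | yes refl | yes refl = ≤∧≢⇒< (≤-pred (*-cancelʳ-< 2 m 8 (s≤s mk≤))) (m≢7 refl refl)
  ... | no  k≢2  | _        = m<a-generic k n m 2≤k 2k<n (λ (k≡2 , _) → k≢2 k≡2) mk≤
  ... | yes _    | no  n≢5  = m<a-generic k n m 2≤k 2k<n (λ (_ , n≡5) → n≢5 n≡5) mk≤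


module Subsets where

  open import Data.Nat using (ℕ; zero; suc; _≤_; _<_; z≤n; s≤s)
  open import Data.Nat.Properties using (≤-trans; ≤-reflexive)
  open import Data.Fin using (Fin; _≟_) renaming (zero to fzero; suc to fsuc)
  open import Data.Fin.Subset
  open import Data.Fin.Subset.Properties
  open import Data.Product using (∃; _×_; _,_)
  open import Data.Bool.Base using (Bool; true; false; if_then_else_)
  open import Data.Sum using (inj₁; inj₂)
  open import Data.Vec.Base using ([]; _∷_; here; there)
  open import Relation.Binary.PropositionalEquality
  open import Function using (_∘_)
  open import Relation.Nullary using (yes; no; contradiction)

  private variable
    n : ℕ
    p q : Subset n
    x : Fin n

  x∈p⇒0<∣p∣ : x ∈ p → 0 < ∣ p ∣
  x∈p⇒0<∣p∣ here                  = s≤s z≤n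
  x∈p⇒0<∣p∣ {p = b ∷ p} (there x∈p) = ≤-trans (x∈p⇒0<∣p∣ x∈p) (∣p∣≤∣x∷p∣ b p)

  ∣p∣≡0⇒p≡⊥ : ∣ p ∣ ≡ 0 → p ≡ ⊥
  ∣p∣≡0⇒p≡⊥ ∣p∣≡0 = Empty-unique λ (_ , x∈p) → contradiction (subst (0 <_) ∣p∣≡0 (x∈p⇒0<∣p∣ x∈p)) λ ()

  ∣p∣≡suc⇒Nonempty : ∀ {s} → ∣ p ∣ ≡ suc s → Nonempty p
  ∣p∣≡suc⇒Nonempty {n} {p} ∣p∣≡1+s with nonempty? p
  ... | yes ne = ne
  ... | no ¬ne = contradiction (trans (sym ∣p∣≡1+s) (trans (cong ∣_∣ (Empty-unique ¬ne)) (∣⊥∣≡0 n))) λ ()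

  x∈p─q⇒x∉q : ∀ (p q : Subset n) → x ∈ p ─ q → x ∉ q
  x∈p─q⇒x∉q (_ ∷ p) (outside ∷ q) here        ()
  x∈p─q⇒x∉q (_ ∷ p) (_       ∷ q) (there x∈p) (there x∈q) = x∈p─q⇒x∉q p q x∈p x∈q

  x∈p-y⇒x≢y : ∀ {y} → x ∈ p - y → x ≢ y
  x∈p-y⇒x≢y {p = p} {y} x∈p-y = x∉⁅y⁆⇒x≢y (x∈p─q⇒x∉q p ⁅ y ⁆ x∈p-y)

  suc∣p-x∣≡∣p∣ : x ∈ p → suc ∣ p - x ∣ ≡ ∣ p ∣
  suc∣p-x∣≡∣p∣ {p = _ ∷ p}       here        = cong (suc ∘ ∣_∣) (p─⊥≡p p)
  suc∣p-x∣≡∣p∣ {p = inside ∷ p}  (there x∈p) = cong suc (suc∣p-x∣≡∣p∣ x∈p)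
  suc∣p-x∣≡∣p∣ {p = outside ∷ p} (there x∈p) = suc∣p-x∣≡∣p∣ x∈p

  p⊆q⇒p-x⊆q-x : p ⊆ q → p - x ⊆ q - x
  p⊆q⇒p-x⊆q-x {p = p} p⊆q y∈p-x = x∈p∧x≢y⇒x∈p-y (p⊆q (p─q⊆p p _ y∈p-x)) (x∈p-y⇒x≢y y∈p-x)

  x∉p⇒p⊆q⇒p⊆q-x : x ∉ p → p ⊆ q → p ⊆ q - x
  x∉p⇒p⊆q⇒p⊆q-x {p = p} x∉p p⊆q y∈p = x∈p∧x≢y⇒x∈p-y (p⊆q y∈p) λ y≡x → x∉p (subst (_∈ p) y≡x y∈p)

  p-x⊆q-x⇒p⊆q : x ∈ q → p - x ⊆ q - x → p ⊆ q
  p-x⊆q-x⇒p⊆q {x = x} {q = q} x∈q p-x⊆q-x {y} y∈p with y ≟ x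
  ... | yes refl = x∈q
  ... | no y≢x   = p─q⊆p q _ (p-x⊆q-x (x∈p∧x≢y⇒x∈p-y y∈p y≢x))

  p-x≡q-x⇒p≡q : x ∈ p → x ∈ q → p - x ≡ q - x → p ≡ q
  p-x≡q-x⇒p≡q x∈p x∈q p-x≡q-x =
    ⊆-antisym (p-x⊆q-x⇒p⊆q x∈q (⊆-reflexive p-x≡q-x)) (p-x⊆q-x⇒p⊆q x∈p (⊆-reflexive (sym p-x≡q-x)))

  ∃-⊆-size : ∀ (q : Subset n) s → s ≤ ∣ q ∣ → ∃ λ p → p ⊆ q × ∣ p ∣ ≡ s
  ∃-⊆-size []            zero    _         = [] , ⊆-refl , refl
  ∃-⊆-size (outside ∷ q) s       s≤∣q∣     with ∃-⊆-size q s s≤∣q∣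
  ... | p , p⊆q , ∣p∣≡s = outside ∷ p , out⊆ p⊆q , ∣p∣≡s
  ∃-⊆-size {suc n} (inside ∷ q) zero _    = ⊥ , ⊥⊆ , ∣⊥∣≡0 (suc n)
  ∃-⊆-size (inside ∷ q)  (suc s) (s≤s s≤∣q∣) with ∃-⊆-size q s s≤∣q∣
  ... | p , p⊆q , ∣p∣≡s = inside ∷ p , in⊆in p⊆q , cong suc ∣p∣≡s

  ∃-∋-size : ∀ (x : Fin n) s → s < n → ∃ λ p → x ∈ p × ∣ p ∣ ≡ suc s
  ∃-∋-size {suc n} fzero    s       (s≤s s≤n) with ∃-⊆-size ⊤ s (≤-trans s≤n (≤-reflexive (sym (∣⊤∣≡n n))))
  ... | p , _ , ∣p∣≡s = inside ∷ p , here , cong suc ∣p∣≡s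
  ∃-∋-size {suc n} (fsuc x) zero    _       = outside ∷ ⁅ x ⁆ , there (x∈⁅x⁆ x) , ∣⁅x⁆∣≡1 x
  ∃-∋-size {suc n} (fsuc x) (suc s) (s≤s s<n) with ∃-∋-size x s s<n
  ... | p , x∈p , ∣p∣≡1+s = inside ∷ p , there x∈p , cong suc ∣p∣≡1+s

  ⋃[_]_ : ∀ {m} → (Fin m → Bool) → (Fin m → Subset n) → Subset n
  ⋃[_]_ {m = zero}  P G = ⊥
  ⋃[_]_ {m = suc m} P G = (if P fzero then G fzero else ⊥) ∪ ⋃[ P ∘ fsuc ] (G ∘ fsuc)

  ⊆⋃ : ∀ {m} (P : Fin m → Bool) (G : Fin m → Subset n) {i} → P i ≡ true → G i ⊆ ⋃[ P ] G
  ⊆⋃ P G {fzero}  P0 x∈G = x∈p∪q⁺ (inj₁ (subst (λ b → _ ∈ (if b then G fzero else ⊥)) (sym P0) x∈G))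
  ⊆⋃ P G {fsuc i} Pi x∈G = x∈p∪q⁺ (inj₂ (⊆⋃ (P ∘ fsuc) (G ∘ fsuc) Pi x∈G))

  ∈⋃ : ∀ {m} (P : Fin m → Bool) (G : Fin m → Subset n) → x ∈ ⋃[ P ] G → ∃ λ i → P i ≡ true × x ∈ G i
  ∈⋃ {m = zero}  P G x∈⋃ = contradiction x∈⋃ ∉⊥
  ∈⋃ {m = suc m} P G x∈⋃ with P fzero in P0 | x∈p∪q⁻ (if P fzero then G fzero else ⊥) _ x∈⋃
  ... | true  | inj₁ x∈G  = fzero , P0 , x∈G
  ... | false | inj₁ x∈⊥  = contradiction x∈⊥ ∉⊥
  ... | _     | inj₂ x∈⋃′ with ∈⋃ (P ∘ fsuc) (G ∘ fsuc) x∈⋃′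
  ...   | i , Pi , x∈G = fsuc i , Pi , x∈G


module Counting where

  open import Data.Nat
  open import Data.Nat.Properties
  open import Data.Nat.Combinatorics using (_C_)
  open import Data.Bool.Base using (Bool; true; false; _∧_; not; _xor_)
  open import Data.Bool.Properties using (not-involutive; not-distribˡ-xor)
  open import Data.Fin.Base using (Fin) renaming (zero to fzero; suc to fsuc)
  open import Data.Fin.Properties using () renaming (suc-injective to fsuc-injective; 0≢1+n to fzero≢fsuc)
  open import Data.Fin.Subset using (Subset; _∈_; _∉_; _⊆_; ∣_∣; _-_)
  open import Data.Fin.Subset.Properties using (p⊆q⇒∣p∣≤∣q∣)
  open import Data.Vec.Base using ([]; _∷_; lookup)
  open import Data.Vec.Properties using (lookup⇒[]=; []=⇒lookup)
  open import Data.Product using (_×_; _,_; proj₁; proj₂)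
  open import Data.Empty using (⊥)
  open import Function using (_∘_)
  open import Relation.Binary.PropositionalEquality
  open import Relation.Nullary using (contradiction)
  open import Algebra.Properties.Semiring.Sum +-*-semiring
    using (sum; sum-cong-≗; ∑-comm; ∑-distrib-+; *-distribˡ-sum; *-distribʳ-sum)
  open import Data.Nat.Divisibility using (_∣_; _∣0; ∣m∣n⇒∣m+n)
  open Binomial using (pascal)
  open Subsets

  private variable
    m n : ℕ

  indicator : Bool → ℕ
  indicator true  = 1
  indicator false = 0

  count : (Fin m → Bool) → ℕ
  count P = sum (indicator ∘ P)

  sum-mono-≤ : {f g : Fin m → ℕ} → (∀ i → f i ≤ g i) → sum f ≤ sum g
  sum-mono-≤ {zero}  f≤g = z≤n
  sum-mono-≤ {suc m} f≤g = +-mono-≤ (f≤g fzero) (sum-mono-≤ (f≤g ∘ fsuc))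

  sum-const : ∀ m c → sum {m} (λ _ → c) ≡ m * c
  sum-const zero    c = refl
  sum-const (suc m) c = cong (c +_) (sum-const m c)

  ∣-sum : ∀ {d} {f : Fin m → ℕ} → (∀ i → d ∣ f i) → d ∣ sum f
  ∣-sum {zero}  {d} _   = d ∣0
  ∣-sum {suc m}     d∣f = ∣m∣n⇒∣m+n (d∣f fzero) (∣-sum (d∣f ∘ fsuc))

  count-true : count {m} (λ _ → true) ≡ m
  count-true {m} = trans (sum-const m 1) (*-identityʳ m)

  count-none : {P : Fin m → Bool} → (∀ {i} → P i ≡ true → ⊥) → count P ≡ 0
  count-none {zero}          none = refl
  count-none {suc m} {P} none with P fzero in P0
  ... | true  = contradiction P0 none
  ... | false = count-none {P = P ∘ fsuc} none

  count≤1 : {P : Fin m → Bool} → (∀ {i j} → P i ≡ true → P j ≡ true → i ≡ j) → count P ≤ 1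
  count≤1 {zero}          unique = z≤n
  count≤1 {suc m} {P} unique with P fzero in P0
  ... | true  = ≤-reflexive (cong suc (count-none {P = P ∘ fsuc} λ Pi → fzero≢fsuc (unique P0 Pi)))
  ... | false = count≤1 {P = P ∘ fsuc} λ Pi Pj → fsuc-injective (unique Pi Pj)

  count-pos : {P : Fin m → Bool} {i : Fin m} → P i ≡ true → 0 < count P
  count-pos {P = P} {fzero}  Pi rewrite Pi = s≤s z≤n
  count-pos {P = P} {fsuc i} Pi = ≤-trans (count-pos {P = P ∘ fsuc} Pi) (m≤n+m _ (indicator (P fzero)))

  count-split : ∀ (P h : Fin m → Bool) → count P ≡ count (λ i → P i ∧ h i) + count (λ i → P i ∧ not (h i))
  count-split P h = trans (sum-cong-≗ λ i → split (P i) (h i))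
                          (∑-distrib-+ (λ i → indicator (P i ∧ h i)) (λ i → indicator (P i ∧ not (h i))))
    where
    split : ∀ p q → indicator p ≡ indicator (p ∧ q) + indicator (p ∧ not q)
    split true  true  = refl
    split true  false = refl
    split false _     = refl

  ∧-true⇒ : ∀ {p q} → p ∧ q ≡ true → p ≡ true × q ≡ true
  ∧-true⇒ {true} {true} _ = refl , refl

  ∧-not-true⇒ : ∀ {p q} → p ∧ not q ≡ true → p ≡ true × q ≡ false
  ∧-not-true⇒ {true} {false} _ = refl , refl

  ∣p∣≡count : ∀ (p : Subset n) → ∣ p ∣ ≡ count (lookup p)
  ∣p∣≡count []          = refl
  ∣p∣≡count (true  ∷ p) = cong suc (∣p∣≡count p)
  ∣p∣≡count (false ∷ p) = ∣p∣≡count p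

  ∑-count-∧ : ∀ (P : Fin m → Bool) (G : Fin m → Subset n) {r} → (∀ i → ∣ G i ∣ ≡ r) →
              sum (λ u → count (λ i → P i ∧ lookup (G i) u)) ≡ count P * r
  ∑-count-∧ {m} {n} P G {r} ∣G∣≡r = begin
    sum (λ u → sum (λ i → indicator (P i ∧ lookup (G i) u)))
      ≡⟨ ∑-comm (λ u i → indicator (P i ∧ lookup (G i) u)) ⟩
    sum (λ i → sum (λ u → indicator (P i ∧ lookup (G i) u)))
      ≡⟨ sum-cong-≗ (λ i → sum-cong-≗ (λ u → indicator-∧ (P i) (lookup (G i) u))) ⟩
    sum (λ i → sum (λ u → indicator (P i) * indicator (lookup (G i) u)))
      ≡⟨ sum-cong-≗ (λ i → sym (*-distribˡ-sum (indicator (P i)) (indicator ∘ lookup (G i)))) ⟩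
    sum (λ i → indicator (P i) * count (lookup (G i)))
      ≡⟨ sum-cong-≗ (λ i → cong (indicator (P i) *_) (trans (sym (∣p∣≡count (G i))) (∣G∣≡r i))) ⟩
    sum (λ i → indicator (P i) * r)
      ≡⟨ sym (*-distribʳ-sum r (indicator ∘ P)) ⟩
    count P * r ∎
    where
    open ≡-Reasoning
    indicator-∧ : ∀ p q → indicator (p ∧ q) ≡ indicator p * indicator q
    indicator-∧ true  q = sym (+-identityʳ _)
    indicator-∧ false q = refl

  record SubsetFamily {m n} (P : Fin m → Bool) (G : Fin m → Subset n) (Z : Subset n) (r : ℕ) : Set where
    field
      ⊆Z       : ∀ {i} → P i ≡ true → G i ⊆ Z
      size     : ∀ {i} → P i ≡ true → ∣ G i ∣ ≡ r
      distinct : ∀ {i j} → P i ≡ true → P j ≡ true → G i ≡ G j → i ≡ j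

  module _ {P : Fin m → Bool} {G : Fin m → Subset n} {Z : Subset n} {u : Fin n} where

    SubsetFamily-∋ : ∀ {r} → u ∈ Z → SubsetFamily P G Z (suc r) →
                     SubsetFamily (λ i → P i ∧ lookup (G i) u) (λ i → G i - u) (Z - u) r
    SubsetFamily-∋ u∈Z fam = record
      { ⊆Z       = λ sel → p⊆q⇒p-x⊆q-x (⊆Z (proj₁ (∧-true⇒ sel)))
      ; size     = λ sel → suc-injective (trans (suc∣p-x∣≡∣p∣ (u∈G sel)) (size (proj₁ (∧-true⇒ sel))))
      ; distinct = λ seli selj eq → distinct (proj₁ (∧-true⇒ seli)) (proj₁ (∧-true⇒ selj))
                                             (p-x≡q-x⇒p≡q (u∈G seli) (u∈G selj) eq)
      }
      where
      open SubsetFamily fam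
      u∈G : ∀ {i} → (P i ∧ lookup (G i) u) ≡ true → u ∈ G i
      u∈G {i} sel = lookup⇒[]= u (G i) (proj₂ (∧-true⇒ sel))

    SubsetFamily-∌ : ∀ {r} → SubsetFamily P G Z r →
                     SubsetFamily (λ i → P i ∧ not (lookup (G i) u)) G (Z - u) r
    SubsetFamily-∌ fam = record
      { ⊆Z       = λ sel → x∉p⇒p⊆q⇒p⊆q-x (u∉G (proj₂ (∧-not-true⇒ sel))) (⊆Z (proj₁ (∧-not-true⇒ sel)))
      ; size     = λ sel → size (proj₁ (∧-not-true⇒ sel))
      ; distinct = λ seli selj → distinct (proj₁ (∧-not-true⇒ seli)) (proj₁ (∧-not-true⇒ selj))
      }
      where
      open SubsetFamily fam
      u∉G : ∀ {i} → lookup (G i) u ≡ false → u ∉ G i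
      u∉G u∉G u∈G = contradiction (trans (sym ([]=⇒lookup u∈G)) u∉G) λ ()

  count≤C : ∀ {P : Fin m → Bool} {G : Fin m → Subset n} {Z r} → SubsetFamily P G Z r → count P ≤ ∣ Z ∣ C r
  count≤C fam = go fam refl
    where
    go : ∀ {m n} {P : Fin m → Bool} {G : Fin m → Subset n} {Z r s} → SubsetFamily P G Z r → ∣ Z ∣ ≡ s → count P ≤ s C r
    go {r = zero} fam _ = count≤1 λ seli selj →
      distinct seli selj (trans (∣p∣≡0⇒p≡⊥ (size seli)) (sym (∣p∣≡0⇒p≡⊥ (size selj))))
      where open SubsetFamily fam
    go {P = P} {r = suc r} {s = zero} fam ∣Z∣≡0 = ≤-reflexive (count-none {P = P} λ sel →
      contradiction (≤-trans (≤-reflexive (sym (size sel))) (≤-trans (p⊆q⇒∣p∣≤∣q∣ (⊆Z sel)) (≤-reflexive ∣Z∣≡0)))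
                    λ ())
      where open SubsetFamily fam
    go {P = P} {G} {Z} {suc r} {suc s} fam ∣Z∣≡1+s with ∣p∣≡suc⇒Nonempty ∣Z∣≡1+s
    ... | u , u∈Z = begin
      count P
        ≡⟨ count-split P (λ i → lookup (G i) u) ⟩
      count (λ i → P i ∧ lookup (G i) u) + count (λ i → P i ∧ not (lookup (G i) u))
        ≤⟨ +-mono-≤ (go (SubsetFamily-∋ u∈Z fam) ∣Z-u∣≡s) (go (SubsetFamily-∌ fam) ∣Z-u∣≡s) ⟩
      s C r + s C suc r
        ≡⟨ sym (pascal s r) ⟩
      suc s C suc r ∎
      where
      open ≤-Reasoning
      ∣Z-u∣≡s = suc-injective (trans (suc∣p-x∣≡∣p∣ u∈Z) ∣Z∣≡1+s)

  odd : ℕ → Bool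
  odd zero    = false
  odd (suc n) = not (odd n)

  odd-+ : ∀ a b → odd (a + b) ≡ odd a xor odd b
  odd-+ zero    b = refl
  odd-+ (suc a) b = trans (cong not (odd-+ a b)) (not-distribˡ-xor (odd a) (odd b))

  odd-*2 : ∀ a → odd (a * 2) ≡ false
  odd-*2 zero    = refl
  odd-*2 (suc a) = trans (not-involutive (odd (a * 2))) (odd-*2 a)

  odd-sum≡odd-count : ∀ (f : Fin m → ℕ) → odd (sum f) ≡ odd (count (odd ∘ f))
  odd-sum≡odd-count {zero}  f = refl
  odd-sum≡odd-count {suc m} f = begin
    odd (f fzero + sum (f ∘ fsuc))
      ≡⟨ odd-+ (f fzero) _ ⟩
    odd (f fzero) xor odd (sum (f ∘ fsuc))
      ≡⟨ cong₂ _xor_ (odd-indicator (odd (f fzero))) (odd-sum≡odd-count (f ∘ fsuc)) ⟩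
    odd (indicator (odd (f fzero))) xor odd (count (odd ∘ f ∘ fsuc))
      ≡⟨ sym (odd-+ (indicator (odd (f fzero))) _) ⟩
    odd (count (odd ∘ f)) ∎
    where
    open ≡-Reasoning
    odd-indicator : ∀ p → p ≡ odd (indicator p)
    odd-indicator true  = refl
    odd-indicator false = refl


open import Defs using (DivisionRing; module LinAlg)

module LinearAlgebra {c ℓ} (D : DivisionRing c ℓ) where

  open DivisionRing D
  open LinAlg D
  open import Algebra.Properties.Ring ring using (-‿distribˡ-*)
  open import Algebra.Properties.CommutativeSemigroup +-commutativeSemigroup using (interchange; x∙yz≈y∙xz)
  open import Relation.Binary.Reasoning.Setoid setoid
  open import Data.Nat.Base using (ℕ; zero; suc)
  open import Data.Nat.Properties using (suc-injective)
  open import Data.Fin.Base using (Fin) renaming (zero to fzero; suc to fsuc)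
  open import Data.Fin.Subset using (Subset; _∈_; ∣_∣; ⊤; inside; outside) renaming (_-_ to _∖_)
  open import Data.Fin.Subset.Properties using (p─⊥≡p; p─q⊆p; drop-there; ∈⊤)
  open import Data.Vec.Base using ([]; _∷_; here; there)
  open import Data.Vec.Functional using (updateAt)
  open import Data.Vec.Functional.Properties using (updateAt-updates; updateAt-minimal)
  open import Data.Product using (∃; _×_; _,_; proj₁; proj₂)
  open import Data.Empty using (⊥; ⊥-elim)
  open import Function using (_∘_)
  open import Relation.Nullary using (¬_)
  import Relation.Binary.PropositionalEquality as ≡
  open ≡ using (_≡_; _≢_)
  open Subsets using (∣p∣≡suc⇒Nonempty; suc∣p-x∣≡∣p∣; x∈p-y⇒x≢y)

  private variable
    d m n : ℕ

  Σ-cong : {f g : Fin m → Carrier} → (∀ i → f i ≈ g i) → Σ[ f ] ≈ Σ[ g ]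
  Σ-cong {zero}  f≈g = refl
  Σ-cong {suc m} f≈g = +-cong (f≈g fzero) (Σ-cong (f≈g ∘ fsuc))

  Σ-+ : ∀ (f g : Fin m → Carrier) → Σ[ (λ i → f i + g i) ] ≈ Σ[ f ] + Σ[ g ]
  Σ-+ {zero}  f g = sym (+-identityˡ 0#)
  Σ-+ {suc m} f g = trans (+-congˡ (Σ-+ (f ∘ fsuc) (g ∘ fsuc))) (interchange _ _ _ _)

  Σ-*ˡ : ∀ x (f : Fin m → Carrier) → Σ[ (λ i → x * f i) ] ≈ x * Σ[ f ]
  Σ-*ˡ {zero}  x f = sym (zeroʳ x)
  Σ-*ˡ {suc m} x f = trans (+-congˡ (Σ-*ˡ x (f ∘ fsuc))) (sym (distribˡ x _ _))

  Σ-0 : ∀ d → Σ[ (λ (_ : Fin d) → 0#) ] ≈ 0#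
  Σ-0 zero    = refl
  Σ-0 (suc d) = trans (+-identityˡ _) (Σ-0 d)

  Σ≈ΣIn⊤ : ∀ (f : Fin m → Carrier) → Σ[ f ] ≈ ΣIn ⊤ f
  Σ≈ΣIn⊤ {zero}  f = refl
  Σ≈ΣIn⊤ {suc m} f = +-congˡ (Σ≈ΣIn⊤ (f ∘ fsuc))

  ΣIn-cong : ∀ (S : Subset n) {f g : Fin n → Carrier} → (∀ {j} → j ∈ S → f j ≈ g j) → ΣIn S f ≈ ΣIn S g
  ΣIn-cong []          f≈g = refl
  ΣIn-cong (inside  ∷ S) f≈g = +-cong (f≈g here) (ΣIn-cong S (f≈g ∘ there))
  ΣIn-cong (outside ∷ S) f≈g = +-congˡ (ΣIn-cong S (f≈g ∘ there))

  ΣIn-zero : ∀ (S : Subset n) {f : Fin n → Carrier} → (∀ {j} → j ∈ S → f j ≈ 0#) → ΣIn S f ≈ 0#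
  ΣIn-zero S {f} f≈0 = trans (ΣIn-cong S f≈0) (ΣIn-0 S)
    where
    ΣIn-0 : ∀ {n} (S : Subset n) → ΣIn S (λ _ → 0#) ≈ 0#
    ΣIn-0 []          = refl
    ΣIn-0 (inside  ∷ S) = trans (+-identityˡ _) (ΣIn-0 S)
    ΣIn-0 (outside ∷ S) = trans (+-identityˡ _) (ΣIn-0 S)

  ΣIn-+ : ∀ (S : Subset n) (f g : Fin n → Carrier) → ΣIn S (λ j → f j + g j) ≈ ΣIn S f + ΣIn S g
  ΣIn-+ []          f g = sym (+-identityˡ 0#)
  ΣIn-+ (inside  ∷ S) f g = trans (+-congˡ (ΣIn-+ S (f ∘ fsuc) (g ∘ fsuc))) (interchange _ _ _ _)
  ΣIn-+ (outside ∷ S) f g =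
    trans (+-identityˡ _) (trans (ΣIn-+ S (f ∘ fsuc) (g ∘ fsuc)) (sym (+-cong (+-identityˡ _) (+-identityˡ _))))

  ΣIn-*ʳ : ∀ (S : Subset n) (f : Fin n → Carrier) x → ΣIn S (λ j → f j * x) ≈ ΣIn S f * x
  ΣIn-*ʳ []          f x = sym (zeroˡ x)
  ΣIn-*ʳ (inside  ∷ S) f x = trans (+-congˡ (ΣIn-*ʳ S (f ∘ fsuc) x)) (sym (distribʳ x _ _))
  ΣIn-*ʳ (outside ∷ S) f x = trans (+-cong (sym (zeroˡ x)) (ΣIn-*ʳ S (f ∘ fsuc) x)) (sym (distribʳ x _ _))

  Σ-ΣIn : ∀ (S : Subset n) (g : Fin n → Fin d → Carrier) → Σ[ (λ p → ΣIn S (λ j → g j p)) ] ≈ ΣIn S (λ j → Σ[ g j ])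
  Σ-ΣIn {d = d} []          g = trans (Σ-cong {m = d} (λ _ → refl)) (Σ-0 d)
  Σ-ΣIn (inside  ∷ S) g = trans (Σ-+ (g fzero) _) (+-congˡ (Σ-ΣIn S (g ∘ fsuc)))
  Σ-ΣIn {d = d} (outside ∷ S) g =
    trans (Σ-cong {m = d} (λ _ → +-identityˡ _)) (trans (Σ-ΣIn S (g ∘ fsuc)) (sym (+-identityˡ _)))

  ΣIn-remove : ∀ (S : Subset n) {j} (f : Fin n → Carrier) → j ∈ S → ΣIn S f ≈ f j + ΣIn (S ∖ j) f
  ΣIn-remove (inside ∷ S) f here =
    +-congˡ (trans (reflexive (≡.cong (λ T → ΣIn T (f ∘ fsuc)) (≡.sym (p─⊥≡p S)))) (sym (+-identityˡ _)))
  ΣIn-remove (inside  ∷ S) f (there j∈S) = trans (+-congˡ (ΣIn-remove S (f ∘ fsuc) j∈S)) (x∙yz≈y∙xz _ _ _)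
  ΣIn-remove (outside ∷ S) f (there j∈S) = trans (+-congˡ (ΣIn-remove S (f ∘ fsuc) j∈S)) (x∙yz≈y∙xz _ _ _)

  e : Fin n → Vect n
  e j = updateAt 0v j (λ _ → 1#)

  e-diag : ∀ (j : Fin n) → e j j ≈ 1#
  e-diag j = reflexive (updateAt-updates j 0v)

  e-off : ∀ {j l : Fin n} → l ≢ j → e j l ≈ 0#
  e-off {j = j} {l} l≢j = reflexive (updateAt-minimal l j 0v l≢j)

  ΣIn-eˡ : ∀ (S : Subset n) {j} (g : Fin n → Carrier) → j ∈ S → ΣIn S (λ l → e j l * g l) ≈ g j
  ΣIn-eˡ S {j} g j∈S = begin
    ΣIn S (λ l → e j l * g l)
      ≈⟨ ΣIn-remove S _ j∈S ⟩
    e j j * g j + ΣIn (S ∖ j) (λ l → e j l * g l)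
      ≈⟨ +-cong (*-congʳ (e-diag j)) (ΣIn-zero (S ∖ j) λ l∈ → trans (*-congʳ (e-off (x∈p-y⇒x≢y l∈))) (zeroˡ _)) ⟩
    1# * g j + 0#
      ≈⟨ trans (+-identityʳ _) (*-identityˡ _) ⟩
    g j ∎

  ΣIn-eʳ : ∀ (S : Subset n) {j} (g : Fin n → Carrier) → j ∈ S → ΣIn S (λ l → g l * e j l) ≈ g j
  ΣIn-eʳ S {j} g j∈S = begin
    ΣIn S (λ l → g l * e j l)
      ≈⟨ ΣIn-remove S _ j∈S ⟩
    g j * e j j + ΣIn (S ∖ j) (λ l → g l * e j l)
      ≈⟨ +-cong (*-congˡ (e-diag j)) (ΣIn-zero (S ∖ j) λ l∈ → trans (*-congˡ (e-off (x∈p-y⇒x≢y l∈))) (zeroʳ _)) ⟩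
    g j * 1# + 0#
      ≈⟨ trans (+-identityʳ _) (*-identityʳ _) ⟩
    g j ∎

  ⟪e,f⟫≈f : ∀ (p : Fin d) (f : Vect d) → ⟪ e p , f ⟫ ≈ f p
  ⟪e,f⟫≈f {d} p f = trans (Σ≈ΣIn⊤ {m = d} (λ q → e p q * f q)) (ΣIn-eˡ ⊤ f ∈⊤)

  ⟪0,f⟫≈0 : ∀ {w : Vect d} (f : Vect d) → w ≋ 0v → ⟪ w , f ⟫ ≈ 0#
  ⟪0,f⟫≈0 {d} f w≋0 = trans (Σ-cong {m = d} λ p → trans (*-congʳ (w≋0 p)) (zeroˡ _)) (Σ-0 d)

  ⟪lcomb,f⟫ : ∀ (v : Fin n → Vect d) S a f → ⟪ lcomb v S a , f ⟫ ≈ ΣIn S (λ j → a j * ⟪ v j , f ⟫)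
  ⟪lcomb,f⟫ {d = d} v S a f = begin
    Σ[ (λ p → ΣIn S (λ j → a j * v j p) * f p) ]
      ≈⟨ Σ-cong {m = d} (λ p → sym (ΣIn-*ʳ S _ (f p))) ⟩
    Σ[ (λ p → ΣIn S (λ j → a j * v j p * f p)) ]
      ≈⟨ Σ-ΣIn S (λ j p → a j * v j p * f p) ⟩
    ΣIn S (λ j → Σ[ (λ p → a j * v j p * f p) ])
      ≈⟨ ΣIn-cong S (λ {j} _ → trans (Σ-cong {m = d} λ p → *-assoc _ _ _) (Σ-*ˡ {m = d} (a j) (λ p → v j p * f p))) ⟩
    ΣIn S (λ j → a j * ⟪ v j , f ⟫) ∎

  ¬¬-∀-Fin : ∀ {q} {Q : Fin n → Set q} → (∀ j → ¬ ¬ Q j) → ¬ ¬ (∀ j → Q j)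
  ¬¬-∀-Fin {zero}  _   ¬∀ = ¬∀ λ ()
  ¬¬-∀-Fin {suc n} ¬¬Q ¬∀ = ¬¬Q fzero λ Q₀ → ¬¬-∀-Fin (¬¬Q ∘ fsuc) λ Qₛ → ¬∀ λ { fzero → Q₀ ; (fsuc j) → Qₛ j }

  ¬∃¬⇒¬¬∀ : ∀ {q} {Q : Fin n → Set q} (S : Subset n) → ¬ (∃ λ j → j ∈ S × ¬ Q j) → ¬ ¬ (∀ {j} → j ∈ S → Q j)
  ¬∃¬⇒¬¬∀ S ¬∃ ¬∀ = ¬¬-∀-Fin (λ j ¬[j∈S→Qj] → ¬[j∈S→Qj] λ j∈S → ⊥-elim (¬∃ (j , j∈S , λ Qj → ¬[j∈S→Qj] λ _ → Qj)))
                             λ ∀Q → ¬∀ λ {j} → ∀Q j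

  eliminate : ∀ (v : Fin n → Vect d) (S : Subset n) {j₀} → j₀ ∈ S → (c : Fin n → Carrier) →
              IndepL v S → IndepL (λ l q → v l q - c l * v j₀ q) (S ∖ j₀)
  eliminate v S {j₀} j₀∈S c indep a′ w-comb≋0 j j∈S′ =
    ≡.subst (_≈ 0#) (updateAt-minimal j j₀ a′ (x∈p-y⇒x≢y j∈S′)) (indep a v-comb≋0 j (p─q⊆p S _ j∈S′))
    where
    S′ = S ∖ j₀
    X = ΣIn S′ (λ l → a′ l * c l)
    a = updateAt a′ j₀ (λ _ → - X)
    split : ∀ l q → a′ l * v l q ≈ a′ l * (v l q - c l * v j₀ q) + a′ l * c l * v j₀ q
    split l q = begin
      a′ l * v l q
        ≈⟨ *-congˡ (sym (trans (+-assoc _ _ _) (trans (+-congˡ (-‿inverseˡ _)) (+-identityʳ _)))) ⟩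
      a′ l * ((v l q - c l * v j₀ q) + c l * v j₀ q)
        ≈⟨ distribˡ _ _ _ ⟩
      a′ l * (v l q - c l * v j₀ q) + a′ l * (c l * v j₀ q)
        ≈⟨ +-congˡ (sym (*-assoc _ _ _)) ⟩
      a′ l * (v l q - c l * v j₀ q) + a′ l * c l * v j₀ q ∎
    rest : ∀ q → ΣIn S′ (λ l → a′ l * v l q) ≈ X * v j₀ q
    rest q = begin
      ΣIn S′ (λ l → a′ l * v l q)
        ≈⟨ ΣIn-cong S′ (λ {l} _ → split l q) ⟩
      ΣIn S′ (λ l → a′ l * (v l q - c l * v j₀ q) + a′ l * c l * v j₀ q)
        ≈⟨ ΣIn-+ S′ _ _ ⟩
      _ + ΣIn S′ (λ l → a′ l * c l * v j₀ q)
        ≈⟨ +-cong (w-comb≋0 q) (ΣIn-*ʳ S′ _ (v j₀ q)) ⟩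
      0# + X * v j₀ q
        ≈⟨ +-identityˡ _ ⟩
      X * v j₀ q ∎
    v-comb≋0 : lcomb v S a ≋ 0v
    v-comb≋0 q = begin
      ΣIn S (λ l → a l * v l q)
        ≈⟨ ΣIn-remove S _ j₀∈S ⟩
      a j₀ * v j₀ q + ΣIn S′ (λ l → a l * v l q)
        ≈⟨ +-cong (*-congʳ (reflexive (updateAt-updates j₀ a′)))
                  (ΣIn-cong S′ λ l∈ → *-congʳ (reflexive (updateAt-minimal _ j₀ a′ (x∈p-y⇒x≢y l∈)))) ⟩
      - X * v j₀ q + ΣIn S′ (λ l → a′ l * v l q)
        ≈⟨ +-cong (sym (-‿distribˡ-* X _)) (rest q) ⟩
      - (X * v j₀ q) + X * v j₀ q
        ≈⟨ -‿inverseˡ _ ⟩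
      0# ∎

  IndepL-tail : ∀ (w : Fin n → Vect (suc d)) (S : Subset n) → (∀ {l} → l ∈ S → w l fzero ≈ 0#) →
                IndepL w S → IndepL (λ l q → w l (fsuc q)) S
  IndepL-tail w S w₀≈0 indep a comb≋0 = indep a λ
    { fzero    → ΣIn-zero S λ l∈ → trans (*-congˡ (w₀≈0 l∈)) (zeroʳ _)
    ; (fsuc q) → comb≋0 q
    }

  -- Without decidable equality in D, the pivot search only yields a double negation, which suffices for ⊥.
  dependent : ∀ d (v : Fin n → Vect d) (S : Subset n) → ∣ S ∣ ≡ suc d → ¬ IndepL v S
  dependent zero v S ∣S∣≡1 indep with ∣p∣≡suc⇒Nonempty ∣S∣≡1
  ... | j , j∈S = 1≉0 (trans (sym (e-diag j)) (indep (e j) (λ ()) j j∈S))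
  dependent {n} (suc d) v S ∣S∣≡2+d indep = ¬∃¬⇒¬¬∀ S pivot zero-column
    where
    reduce : ∀ {j₀} → j₀ ∈ S → (c : Fin n → Carrier) → (∀ {l} → l ∈ S ∖ j₀ → v l fzero ≈ c l * v j₀ fzero) → ⊥
    reduce {j₀} j₀∈S c column = dependent d (λ l q → w l (fsuc q)) (S ∖ j₀)
      (suc-injective (≡.trans (suc∣p-x∣≡∣p∣ j₀∈S) ∣S∣≡2+d))
      (IndepL-tail w (S ∖ j₀) w₀≈0 (eliminate v S j₀∈S c indep))
      where
      w : Fin n → Vect (suc d)
      w l q = v l q - c l * v j₀ q
      w₀≈0 : ∀ {l} → l ∈ S ∖ j₀ → w l fzero ≈ 0#
      w₀≈0 l∈ = trans (+-congʳ (column l∈)) (-‿inverseʳ _)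
    pivot : ¬ (∃ λ j → j ∈ S × ¬ (v j fzero ≈ 0#))
    pivot (j₀ , j₀∈S , p≉0) = reduce j₀∈S (λ l → v l fzero * p⁻¹) λ _ →
      sym (trans (*-assoc _ _ _) (trans (*-congˡ p⁻¹p≈1) (*-identityʳ _)))
      where
      p⁻¹ = proj₁ (inverse _ p≉0)
      p⁻¹p≈1 = proj₂ (proj₂ (inverse _ p≉0))
    zero-column : ¬ (∀ {j} → j ∈ S → v j fzero ≈ 0#)
    zero-column column≈0 with ∣p∣≡suc⇒Nonempty ∣S∣≡2+d
    ... | j₀ , j₀∈S = reduce j₀∈S (λ _ → 0#) λ l∈ → trans (column≈0 (p─q⊆p S _ l∈)) (sym (zeroˡ _))

  annihilator-zero : ∀ (x : Fin n → Vect d) (S : Subset n) → ∣ S ∣ ≡ d → IndepL x S →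
                     (f : Vect d) → (∀ {j} → j ∈ S → ⟪ x j , f ⟫ ≈ 0#) → ∀ p → ¬ ¬ (f p ≈ 0#)
  annihilator-zero {n} {d} x S ∣S∣≡d indep f x⊥f p fp≉0 = dependent d v (inside ∷ S) (≡.cong suc ∣S∣≡d) indep-v
    where
    v : Fin (suc n) → Vect d
    v fzero    = e p
    v (fsuc j) = x j
    indep-v : IndepL v (inside ∷ S)
    indep-v a comb≋0 = λ { fzero _ → a₀≈0 ; (fsuc j) j∈ → indep (a ∘ fsuc) x-comb≋0 j (drop-there j∈) }
      where
      a₀fp≈0 : a fzero * f p ≈ 0#
      a₀fp≈0 = begin
        a fzero * f p                                  ≈⟨ sym (+-identityʳ _) ⟩
        a fzero * f p + 0#                             ≈⟨ sym (+-cong (*-congˡ (⟪e,f⟫≈f p f))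
                                                                       (ΣIn-zero S λ j∈ → trans (*-congˡ (x⊥f j∈)) (zeroʳ _))) ⟩
        ΣIn (inside ∷ S) (λ j → a j * ⟪ v j , f ⟫)     ≈⟨ sym (⟪lcomb,f⟫ v (inside ∷ S) a f) ⟩
        ⟪ lcomb v (inside ∷ S) a , f ⟫                 ≈⟨ ⟪0,f⟫≈0 f comb≋0 ⟩
        0#                                             ∎
      a₀≈0 : a fzero ≈ 0#
      a₀≈0 = begin
        a fzero                ≈⟨ sym (*-identityʳ _) ⟩
        a fzero * 1#           ≈⟨ *-congˡ (sym (proj₁ (proj₂ (inverse _ fp≉0)))) ⟩
        a fzero * (f p * _)    ≈⟨ sym (*-assoc _ _ _) ⟩
        a fzero * f p * _      ≈⟨ *-congʳ a₀fp≈0 ⟩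
        0# * _                 ≈⟨ zeroˡ _ ⟩
        0#                     ∎
      x-comb≋0 : lcomb x S (a ∘ fsuc) ≋ 0v
      x-comb≋0 q = trans (sym (+-identityˡ _)) (trans (+-congʳ (sym (trans (*-congʳ a₀≈0) (zeroˡ _)))) (comb≋0 q))

  IndepR⇒nonzero : ∀ (y : Fin n → Vect d) (S : Subset n) {b} → b ∈ S → IndepR y S → ¬ (∀ p → y b p ≈ 0#)
  IndepR⇒nonzero y S {b} b∈S indep yb≈0 =
    1≉0 (trans (sym (e-diag b)) (indep (e b) (λ p → trans (ΣIn-eʳ S (λ l → y l p) b∈S) (yb≈0 p)) b b∈S))

  ≐ann⇒⟪⟫≈0 : ∀ (x y : Fin n → Vect d) (F T : Subset n) → spanL x F ≐ ann (spanR y T) →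
              ∀ {j b} → j ∈ F → b ∈ T → ⟪ x j , y b ⟫ ≈ 0#
  ≐ann⇒⟪⟫≈0 x y F T F≐annT {j} {b} j∈F b∈T =
    proj₁ (F≐annT (x j)) (e j , λ p → sym (ΣIn-eˡ F (λ l → x l p) j∈F))
                         (y b) (e b , λ p → sym (ΣIn-eʳ T (λ l → y l p) b∈T))


open import Data.Nat.Base using (ℕ; suc; _<_)
open import Data.Fin.Base using (Fin)
open import Data.Fin.Subset using (Subset; ∣_∣)
open import Relation.Binary.PropositionalEquality using (_≡_)

module Configuration {c ℓ} (D : DivisionRing c ℓ) {d n m k : ℕ} (d<n : d < n)
  (x y : Fin n → LinAlg.Vect D (suc d))
  (indX : LinAlg.IndepLOf D (suc d) x) (indY : LinAlg.IndepROf D (suc d) y)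
  (F T : Fin m → Subset n) (∣F∣≡k : ∀ i → ∣ F i ∣ ≡ k) (∣T∣≡k : ∀ i → ∣ T i ∣ ≡ k)
  (F≐annT : ∀ i → LinAlg._≐_ D (LinAlg.spanL D x (F i)) (LinAlg.ann D (LinAlg.spanR D y (T i))))
  (F-injective : ∀ {i j} → F i ≡ F j → i ≡ j) where

  open import Data.Nat.Base using (_≤_; _*_)
  open import Data.Nat.Properties using (_≤?_; ≰⇒>; ≤-trans; +-*-semiring; module ≤-Reasoning)
  open import Data.Nat.Combinatorics using (_C_)
  open import Data.Bool.Base using (Bool; true; _∧_)
  open import Data.Bool.Properties using (∧-comm)
  open import Data.Fin.Subset using (_∈_; _∉_)
  open import Data.Vec.Base using (lookup)
  open import Data.Vec.Properties using (lookup⇒[]=; []=⇒lookup)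
  open import Data.Product using (_,_; proj₁; proj₂)
  open import Data.Empty using (⊥-elim)
  open import Relation.Nullary using (yes; no)
  open import Relation.Binary.PropositionalEquality using (refl; sym; trans; cong; cong₂)
  open import Algebra.Properties.Semiring.Sum +-*-semiring using (sum; sum-cong-≗)
  open DivisionRing D using (_≈_; 0#)
  open LinAlg D using (⟪_,_⟫)
  open LinearAlgebra D
  open Subsets
  open Counting
  open Binomial using (C-monoˡ-≤)

  T∋ : Fin n → Fin m → Bool
  T∋ b i = lookup (T i) b

  Z : Fin n → Subset n
  Z b = ⋃[ T∋ b ] F

  x⊥y : ∀ b {u} → u ∈ Z b → ⟪ x u , y b ⟫ ≈ 0#
  x⊥y b u∈Z with ∈⋃ (T∋ b) F u∈Z
  ... | i , b∈T , u∈F = ≐ann⇒⟪⟫≈0 x y (F i) (T i) (F≐annT i) u∈F (lookup⇒[]= b (T i) b∈T)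

  -- More than d vectors of Z b would span the whole space, forcing y b = 0.
  ∣Z∣≤d : ∀ b → ∣ Z b ∣ ≤ d
  ∣Z∣≤d b with ∣ Z b ∣ ≤? d
  ... | yes ∣Z∣≤d = ∣Z∣≤d
  ... | no  ∣Z∣≰d with ∃-⊆-size (Z b) (suc d) (≰⇒> ∣Z∣≰d) | ∃-∋-size b d d<n
  ...   | S , S⊆Z , ∣S∣≡1+d | S′ , b∈S′ , ∣S′∣≡1+d = ⊥-elim (¬¬-∀-Fin
          (annihilator-zero x S ∣S∣≡1+d (indX S ∣S∣≡1+d) (y b) (λ j∈S → x⊥y b (S⊆Z j∈S)))
          (IndepR⇒nonzero y S′ b∈S′ (indY S′ ∣S′∣≡1+d)))

  family : ∀ b → SubsetFamily (T∋ b) F (Z b) k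
  family b = record
    { ⊆Z       = ⊆⋃ (T∋ b) F
    ; size     = λ {i} _ → ∣F∣≡k i
    ; distinct = λ _ _ → F-injective
    }

  count-T∋≤dCk : ∀ b → count (T∋ b) ≤ d C k
  count-T∋≤dCk b = ≤-trans (count≤C (family b)) (C-monoˡ-≤ k (∣Z∣≤d b))

  ∑count-T∋≡m*k : sum (λ b → count (T∋ b)) ≡ m * k
  ∑count-T∋≡m*k = trans (∑-count-∧ (λ _ → true) T ∣T∣≡k) (cong (_* k) (count-true {m}))

  m*k≤n*dCk : m * k ≤ n * (d C k)
  m*k≤n*dCk = begin
    m * k                         ≡⟨ sym ∑count-T∋≡m*k ⟩
    sum (λ b → count (T∋ b))      ≤⟨ sum-mono-≤ count-T∋≤dCk ⟩
    sum {n} (λ _ → d C k)         ≡⟨ sum-const n (d C k) ⟩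
    n * (d C k)                   ∎
    where open ≤-Reasoning

  V : Fin n → Fin n → ℕ
  V b u = count (λ i → T∋ b i ∧ lookup (F i) u)

  ∑V-row : ∀ b → sum (V b) ≡ count (T∋ b) * k
  ∑V-row b = ∑-count-∧ (T∋ b) F ∣F∣≡k

  ∑V-column : ∀ u → sum (λ b → V b u) ≡ count (λ i → lookup (F i) u) * k
  ∑V-column u = trans (sum-cong-≗ λ b → sum-cong-≗ λ i → cong indicator (∧-comm (T∋ b i) (lookup (F i) u)))
                      (∑-count-∧ (λ i → lookup (F i) u) T ∣T∣≡k)

  V-outside : ∀ {b u} → u ∉ Z b → V b u ≡ 0
  V-outside {b} {u} u∉Z = count-none {P = λ i → T∋ b i ∧ lookup (F i) u} λ {i} sel →
    u∉Z (⊆⋃ (T∋ b) F (proj₁ (∧-true⇒ sel)) (lookup⇒[]= u (F i) (proj₂ (∧-true⇒ sel))))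

  V-inside : ∀ {b u} → u ∈ Z b → 0 < V b u
  V-inside {b} {u} u∈Z with ∈⋃ (T∋ b) F u∈Z
  ... | i , b∈T , u∈F = count-pos {P = λ i → T∋ b i ∧ lookup (F i) u} {i}
                          (cong₂ _∧_ b∈T ([]=⇒lookup u∈F))


module SevenSubsets {c ℓ} (D : DivisionRing c ℓ)
  (x y : Fin 5 → LinAlg.Vect D 4)
  (indX : LinAlg.IndepLOf D 4 x) (indY : LinAlg.IndepROf D 4 y)
  (F T : Fin 7 → Subset 5) (∣F∣≡2 : ∀ i → ∣ F i ∣ ≡ 2) (∣T∣≡2 : ∀ i → ∣ T i ∣ ≡ 2)
  (F≐annT : ∀ i → LinAlg._≐_ D (LinAlg.spanL D x (F i)) (LinAlg.ann D (LinAlg.spanR D y (T i))))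
  (F-injective : ∀ {i j} → F i ≡ F j → i ≡ j) where

  open import Data.Nat.Base
  open import Data.Nat.Properties
  open import Data.Nat.Combinatorics using (_C_; nC1≡n)
  open import Data.Nat.Divisibility using (_∣_; _∣0; ∣-refl; _∣?_)
  open import Data.Bool.Base using (true; false)
  open import Data.Bool.Properties using (¬-not) renaming (_≟_ to _≟ᵇ_)
  open import Data.Fin.Properties using (any?)
  open import Data.Fin.Subset using (_∈_; _∉_; _-_)
  open import Data.Fin.Subset.Properties using (nonempty?; Empty-unique; ∣⊥∣≡0)
  open import Data.Vec.Base using (lookup)
  open import Data.Vec.Properties using (lookup⇒[]=; []=⇒lookup)
  open import Data.Product using (_×_; _,_; proj₁; proj₂; ∃₂)
  open import Data.Sum using (_⊎_; inj₁; inj₂)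
  open import Data.Empty using (⊥)
  open import Function using (_∘_)
  open import Relation.Binary.PropositionalEquality
  open import Relation.Nullary using (¬_; yes; no; contradiction)
  open import Relation.Nullary.Decidable using (toWitnessFalse)
  open import Algebra.Properties.Semiring.Sum +-*-semiring
    using (sum; sum-cong-≗; ∑-distrib-+; *-distribˡ-sum; *-distribʳ-sum)
  open Counting
  open Subsets using (suc∣p-x∣≡∣p∣)

  module ThreeElementRow {n} (r : Fin n → ℕ) (Z : Subset n) (∣Z∣≤3 : ∣ Z ∣ ≤ 3)
    (inside : ∀ {u} → u ∈ Z → 0 < r u × r u < ∣ Z ∣) (outside : ∀ {u} → u ∉ Z → r u ≡ 0)
    (even : odd (sum r) ≡ false) where

    private
      1≤r<3 : ∀ {u} → lookup Z u ≡ true → 0 < r u × r u < 3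
      1≤r<3 {u} u∈Z = let (0<r , r<∣Z∣) = inside (lookup⇒[]= u Z u∈Z) in 0<r , ≤-trans r<∣Z∣ ∣Z∣≤3

      r≡0 : ∀ {u} → lookup Z u ≡ false → r u ≡ 0
      r≡0 {u} u∉Z = outside λ u∈Z → contradiction (trans (sym ([]=⇒lookup u∈Z)) u∉Z) λ ()

    r+odd≤2 : ∀ u → r u + indicator (odd (r u)) ≤ 2 * indicator (lookup Z u)
    r+odd≤2 u with lookup Z u in eq
    ... | false rewrite r≡0 eq = z≤n
    ... | true  = small (1≤r<3 eq)
      where
      small : ∀ {a} → 0 < a × a < 3 → a + indicator (odd a) ≤ 2
      small {1} _ = ≤-refl
      small {2} _ = ≤-refl
      small {suc (suc (suc _))} (_ , s≤s (s≤s (s≤s ())))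

    sum+count≤6 : sum r + count (odd ∘ r) ≤ 6
    sum+count≤6 = begin
      sum r + count (odd ∘ r)                   ≡⟨ sym (∑-distrib-+ r (indicator ∘ odd ∘ r)) ⟩
      sum (λ u → r u + indicator (odd (r u)))   ≤⟨ sum-mono-≤ r+odd≤2 ⟩
      sum (λ u → 2 * indicator (lookup Z u))    ≡⟨ sym (*-distribˡ-sum 2 (indicator ∘ lookup Z)) ⟩
      2 * count (lookup Z)                      ≡⟨ cong (2 *_) (sym (∣p∣≡count Z)) ⟩
      2 * ∣ Z ∣                                 ≤⟨ *-monoʳ-≤ 2 ∣Z∣≤3 ⟩
      6                                         ∎
      where open ≤-Reasoning

    row-bound : ∀ u → sum r + 2 * indicator (odd (r u)) ≤ 6
    row-bound u with odd (r u) in odd-ru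
    ... | false = ≤-trans (≤-reflexive (+-identityʳ _)) (≤-trans (m≤m+n _ _) sum+count≤6)
    ... | true  = ≤-trans (≤-reflexive (+-comm (sum r) 2))
                    (even-step (sum r) even (≤-trans (≤-reflexive (+-comm 1 (sum r)))
                      (≤-trans (+-monoʳ-≤ (sum r) (count-pos {P = odd ∘ r} odd-ru)) sum+count≤6)))
      where
      even-step : ∀ s → odd s ≡ false → suc s ≤ 6 → 2 + s ≤ 6
      even-step 0 _ _ = s≤s (s≤s z≤n)
      even-step 2 _ _ = s≤s (s≤s (s≤s (s≤s z≤n)))
      even-step 4 _ _ = ≤-refl
      even-step (suc (suc (suc (suc (suc (suc _)))))) _ (s≤s (s≤s (s≤s (s≤s (s≤s (s≤s ()))))))

    row-even⇒6∣ : (∀ u → odd (r u) ≡ false) → 6 ∣ sum r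
    row-even⇒6∣ all-even = subst (6 ∣_) (sym sum≡2∣Z∣) 6∣2∣Z∣
      where
      r≡2[u∈Z] : ∀ u → r u ≡ 2 * indicator (lookup Z u)
      r≡2[u∈Z] u with lookup Z u in eq
      ... | false = r≡0 eq
      ... | true  = two (1≤r<3 eq) (all-even u)
        where
        two : ∀ {a} → 0 < a × a < 3 → odd a ≡ false → a ≡ 2
        two {2} _ _ = refl
        two {suc (suc (suc _))} (_ , s≤s (s≤s (s≤s ()))) _
      sum≡2∣Z∣ : sum r ≡ 2 * ∣ Z ∣
      sum≡2∣Z∣ = trans (sum-cong-≗ r≡2[u∈Z])
                       (trans (sym (*-distribˡ-sum 2 (indicator ∘ lookup Z))) (cong (2 *_) (sym (∣p∣≡count Z))))
      ∣Z∣≡0⊎∣Z∣≡3 : ∣ Z ∣ ≡ 0 ⊎ ∣ Z ∣ ≡ 3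
      ∣Z∣≡0⊎∣Z∣≡3 with nonempty? Z
      ... | no  empty      = inj₁ (trans (cong ∣_∣ (Empty-unique empty)) (∣⊥∣≡0 n))
      ... | yes (u , u∈Z) = inj₂ (≤-antisym ∣Z∣≤3 (subst (_< ∣ Z ∣) r≡2 (proj₂ (inside u∈Z))))
        where
        r≡2 : r u ≡ 2
        r≡2 = trans (r≡2[u∈Z] u) (cong (λ b → 2 * indicator b) ([]=⇒lookup u∈Z))
      6∣2∣Z∣ : 6 ∣ 2 * ∣ Z ∣
      6∣2∣Z∣ with ∣Z∣≡0⊎∣Z∣≡3
      ... | inj₁ ∣Z∣≡0 rewrite ∣Z∣≡0 = 6 ∣0
      ... | inj₂ ∣Z∣≡3 rewrite ∣Z∣≡3 = ∣-refl

  open Configuration D (s≤s (s≤s (s≤s (s≤s z≤n)))) x y indX indY F T ∣F∣≡2 ∣T∣≡2 F≐annT F-injective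

  V<∣Z∣ : ∀ {b u} → u ∈ Z b → V b u < ∣ Z b ∣
  V<∣Z∣ {b} {u} u∈Z = begin-strict
    V b u               ≤⟨ count≤C (SubsetFamily-∋ u∈Z (family b)) ⟩
    ∣ (Z b - u) ∣ C 1   ≡⟨ nC1≡n _ ⟩
    ∣ (Z b - u) ∣       <⟨ ≤-reflexive (suc∣p-x∣≡∣p∣ u∈Z) ⟩
    ∣ Z b ∣             ∎
    where open ≤-Reasoning

  module Row b = ThreeElementRow (V b) (Z b) (∣Z∣≤d b) (λ u∈Z → V-inside u∈Z , V<∣Z∣ u∈Z) V-outside
                   (trans (cong odd (∑V-row b)) (odd-*2 (count (T∋ b))))

  ∑rows≡28 : sum (λ b → sum (V b)) ≡ 28
  ∑rows≡28 = begin
    sum (λ b → sum (V b))            ≡⟨ sum-cong-≗ ∑V-row ⟩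
    sum (λ b → count (T∋ b) * 2)     ≡⟨ sym (*-distribʳ-sum 2 (count ∘ T∋)) ⟩
    sum (λ b → count (T∋ b)) * 2     ≡⟨ cong (_* 2) ∑count-T∋≡m*k ⟩
    28                               ∎
    where open ≡-Reasoning

  -- An odd entry V b u has a second one in its column, whose sum 2 · deg u is even,
  -- and a row containing an odd entry sums to at most 4.
  no-odd-entry : ¬ ∃₂ λ b u → odd (V b u) ≡ true
  no-odd-entry (b , u , odd-Vbu) = toWitnessFalse {a? = 32 ≤? 30} _ 32≤30
    where
    open ≤-Reasoning
    even-pos⇒≥2 : ∀ {a} → odd a ≡ false → 0 < a → 2 ≤ a
    even-pos⇒≥2 {suc (suc a)} _ _ = s≤s (s≤s z≤n)
    column-even : odd (sum (λ b → V b u)) ≡ false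
    column-even = trans (cong odd (∑V-column u)) (odd-*2 (count (λ i → lookup (F i) u)))
    two-odd : 2 ≤ count (λ b → odd (V b u))
    two-odd = even-pos⇒≥2 (trans (sym (odd-sum≡odd-count (λ b → V b u))) column-even)
                          (count-pos {P = λ b → odd (V b u)} odd-Vbu)
    32≤30 : 28 + 2 * 2 ≤ 30
    32≤30 = begin
      28 + 2 * 2
        ≤⟨ +-monoʳ-≤ 28 (*-monoʳ-≤ 2 two-odd) ⟩
      28 + 2 * count (λ b → odd (V b u))
        ≡⟨ cong (_+ 2 * count (λ b → odd (V b u))) (sym ∑rows≡28) ⟩
      sum (λ b → sum (V b)) + 2 * count (λ b → odd (V b u))
        ≡⟨ cong (sum (λ b → sum (V b)) +_) (*-distribˡ-sum 2 (λ b → indicator (odd (V b u)))) ⟩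
      sum (λ b → sum (V b)) + sum (λ b → 2 * indicator (odd (V b u)))
        ≡⟨ sym (∑-distrib-+ (λ b → sum (V b)) (λ b → 2 * indicator (odd (V b u)))) ⟩
      sum (λ b → sum (V b) + 2 * indicator (odd (V b u)))
        ≤⟨ sum-mono-≤ (λ b → Row.row-bound b u) ⟩
      sum {5} (λ _ → 6)
        ≡⟨ sum-const 5 6 ⟩
      30 ∎

  all-even-impossible : ¬ (∀ b u → odd (V b u) ≡ false)
  all-even-impossible all-even = toWitnessFalse {a? = 6 ∣? 28} _
    (subst (6 ∣_) ∑rows≡28 (∣-sum (λ b → Row.row-even⇒6∣ b (all-even b))))

  impossible : ⊥
  impossible with any? (λ b → any? (λ u → odd (V b u) ≟ᵇ true))
  ... | yes odd-entry = no-odd-entry odd-entry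
  ... | no  no-odd    = all-even-impossible λ b u → ¬-not λ odd-Vbu → no-odd (b , u , odd-Vbu)


open import Defs
open import Data.Nat using (ℕ; _≤_; _<_; _*_)
open import Data.Fin using (Fin)
open import Data.Fin.Subset using (Subset; ∣_∣; ⁅_⁆)
open import Data.Product using (∃; _×_)
open import Relation.Nullary using (¬_)
open import Relation.Binary.PropositionalEquality using (_≡_)

open import Data.Nat using (z≤n; s≤s)
open import Data.Nat.Properties using (<⇒≤)
open import Data.Fin using (_≟_)
open import Data.Product using (_,_; proj₁; proj₂)
open import Relation.Nullary.Decidable using (decidable-stable)
open import Relation.Binary.PropositionalEquality using (refl; subst)
open import Function using (id)

lemma4p8 : ∀ {c ℓ} (D : DivisionRing c ℓ) → let open LinAlg D in
    (k n : ℕ) → 2 ≤ k → 2 * k < n →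
    (x : Fin n → Vect (2 * k)) (y : Fin n → Vect (2 * k)) →
    IndepLOf (2 * k) x → IndepROf (2 * k) y →
    (∀ i → ∃ λ S → ker (y i) ≐ spanL x S) →
    (∀ i → ∃ λ T → spanL x ⁅ i ⁆ ≐ ⋂ (λ j → ker (y j)) T) →
    (m : ℕ) (F : Fin m → Subset n) →
    (∀ i → ∣ F i ∣ ≡ k) →
    (∀ i → ∃ λ T → ∣ T ∣ ≡ k × (spanL x (F i) ≐ ann (spanR y T))) →
    (∀ i j → ¬ i ≡ j → ¬ (spanL x (F i) ≐ spanL x (F j))) →
    m < a n k
lemma4p8 D k n 2≤k@(s≤s (s≤s z≤n)) 2k<n x y indX indY _ _ m F ∣F∣≡k hZ F-distinct =
  Binomial.m<a k n m 2≤k 2k<n (Configuration.m*k≤n*dCk D (<⇒≤ 2k<n) x y indX indY F T ∣F∣≡k ∣T∣≡k F≐annT F-injective)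
    λ { refl refl refl → SevenSubsets.impossible D x y indX indY F T ∣F∣≡k ∣T∣≡k F≐annT F-injective }
  where
  open LinAlg D using (spanL; spanR; ann; _≐_)
  T : Fin m → Subset n
  T i = proj₁ (hZ i)
  ∣T∣≡k : ∀ i → ∣ T i ∣ ≡ k
  ∣T∣≡k i = proj₁ (proj₂ (hZ i))
  F≐annT : ∀ i → spanL x (F i) ≐ ann (spanR y (T i))
  F≐annT i = proj₂ (proj₂ (hZ i))
  F-injective : ∀ {i j} → F i ≡ F j → i ≡ j
  F-injective {i} {j} Fi≡Fj = decidable-stable (i ≟ j) λ i≢j →
    F-distinct i j i≢j (subst (λ S → spanL x (F i) ≐ spanL x S) Fi≡Fj λ _ → id , id)
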